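{- Let $n \ge 1$ be an integer and let $(x_i)_{i=0}^\infty$ be an onion De Bruijn sequence of order $n$. Let $y=\sigma_1\cdots\sigma_{n-1}$ be any word in $\mathbb{N}_0^{\,n-1}$, and put $\mu_y=\max_i \sigma_i$. Then the words $y\tau$ with $\tau \ge \mu_y$ appear in $(x_i)_{i=0}^\infty$ in increasing order of $\tau$: whenever $\mu_y \le \tau < \tau'$, the word $y\tau$ occurs in the sequence at an earlier index than the word $y\tau'$.
   Context: Let $\mathbb{N}_0=\{0,1,2,\dots\}$ and, for an integer $k\ge 1$, let $[k]=\{0,\dots,k-1\}$. Words are finite strings, and juxtaposition denotes concatenation. For integers $n,k \ge 1$, an $(n,k)$-De Bruijn sequence is a sequence $(w_i)_{i=0}^{k^n-1}$ of pairwise distinct words in $[k]^n$ (hence every word of $[k]^n$ occurs exactly once) such that consecutive words overlap: if $w_i=\sigma x$ with $\sigma$ a letter and $x$ a word of length $n-1$, then $w_{i+1}=x\tau$ for some letter $\tau$. A De Bruijn sequence of order $n$ over the alphabet $\mathbb{N}_0$ is a sequence $(x_i)_{i=0}^\infty$ of words in $\mathbb{N}_0^{\,n}$ in which every word of $\mathbb{N}_0^{\,n}$ occurs exactly once and consecutive words overlap in the same sense. Such a sequence is an onion De Bruijn sequence of order $n$ if, for every $k\ge 1$, the initial segment $(x_i)_{i=0}^{k^n-1}$ is an $(n,k)$-De Bruijn sequence. -}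

module Defs where

open import Data.Nat using (ℕ; suc; _<_; _≤_; _^_; _⊔_)
open import Data.Vec using (Vec; tail; init; _∷ʳ_; foldr)
open import Data.Vec.Relation.Unary.All using (All)
open import Data.Product using (Σ; _×_)
open import Relation.Binary.PropositionalEquality using (_≡_)

-- A word of length n over ℕ₀ is a Vec ℕ n; sequences are indexed by ℕ.
-- We write the order as n = suc m (n ≥ 1).

Overlap : ∀ {m} → Vec ℕ (suc m) → Vec ℕ (suc m) → Set
Overlap w w' = tail w ≡ init w'

IsDeBruijnSegment : ∀ m → (k : ℕ) → (ℕ → Vec ℕ (suc m)) → Set
IsDeBruijnSegment m k x =
  (∀ i → i < k ^ suc m → All (_< k) (x i))
  × (∀ i j → i < k ^ suc m → j < k ^ suc m → x i ≡ x j → i ≡ j)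
  × (∀ i → suc i < k ^ suc m → Overlap (x i) (x (suc i)))

IsDeBruijnℕ : ∀ m → (ℕ → Vec ℕ (suc m)) → Set
IsDeBruijnℕ m x =
  (∀ (w : Vec ℕ (suc m)) → Σ ℕ (λ i → x i ≡ w))
  × (∀ i j → x i ≡ x j → i ≡ j)
  × (∀ i → Overlap (x i) (x (suc i)))

IsOnionDeBruijn : ∀ m → (ℕ → Vec ℕ (suc m)) → Set
IsOnionDeBruijn m x =
  IsDeBruijnℕ m x × (∀ k → 1 ≤ k → IsDeBruijnSegment m k x)

maxLetter : ∀ {m} → Vec ℕ m → ℕ
maxLetter = foldr _ _⊔_ 0

module Submission where

-- Fix y with μ_y ≤ τ < τ' and put k = τ + 1.  The word
-- yτ has all letters below k, while yτ' does not (its last letter is τ' ≥ k).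
-- The onion property says that x 0, …, x (kⁿ - 1) are kⁿ pairwise distinct
-- words of [k]ⁿ.  Since [k]ⁿ has exactly kⁿ elements, this initial segment
-- exhausts [k]ⁿ, so yτ occurs at some index below kⁿ; and every word there
-- lies in [k]ⁿ, so yτ' occurs only at an index ≥ kⁿ.  Uniqueness of
-- occurrences in the whole sequence then gives i < kⁿ ≤ j.

open import Defs
open import Data.Nat using (ℕ; suc; _<_; _≤_; _^_; z≤n; s≤s; s≤s⁻¹; _<?_)
open import Data.Nat.Properties
  using (_≟_; ≤-refl; ≤-trans; <-≤-trans; <⇒≢; <⇒≱; ≮⇒≥; n<1+n; m≤m⊔n; m≤n⊔m)
open import Data.Vec using (Vec; []; _∷_; _∷ʳ_)
open import Data.Vec.Properties using (≡-dec)
open import Data.Vec.Relation.Unary.All using (All; []; _∷_)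
open import Data.Fin as Fin using (Fin; toℕ; fromℕ<; combine)
open import Data.Fin.Properties using (toℕ-fromℕ<; toℕ<n; combine-injective; pigeonhole; any?)
open import Data.Product using (Σ; _×_; _,_; proj₁; ∃₂)
open import Data.Empty using (⊥; ⊥-elim)
open import Relation.Nullary using (yes; no)
open import Relation.Binary.Definitions using (DecidableEquality)
open import Relation.Binary.PropositionalEquality using (_≡_; refl; sym; trans; cong; cong₂; subst)

-- Words of length n over [k], read as base-k numerals, give an injective
-- map [k]ⁿ → Fin (kⁿ).  This is how we count [k]ⁿ.
encode : ∀ {k n} (w : Vec ℕ n) → All (_< k) w → Fin (k ^ n)
encode []      []          = Fin.zero
encode (a ∷ w) (a<k ∷ w<k) = combine (fromℕ< a<k) (encode w w<k)

encode-injective : ∀ {k n} (w w' : Vec ℕ n) (p : All (_< k) w) (p' : All (_< k) w') →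
  encode w p ≡ encode w' p' → w ≡ w'
encode-injective []      []        []      []        _ = refl
encode-injective (a ∷ w) (a' ∷ w') (p ∷ ps) (p' ∷ ps') eq
  with combine-injective _ _ _ _ eq
... | heads , tails = cong₂ _∷_ same-head (encode-injective w w' ps ps' tails)
  where
  same-head : a ≡ a'
  same-head = trans (sym (toℕ-fromℕ< p)) (trans (cong toℕ heads) (toℕ-fromℕ< p'))

-- Pigeonhole, in the form we need: if the P-elements of A inject into Fin N
-- and f 0, …, f (N-1) are N distinct P-elements, then every P-element is
-- among them.  (Otherwise f together with w would give N+1 distinct codes.)
injective-segment-exhausts :
  ∀ {a p} {A : Set a} {P : A → Set p} {N : ℕ} →
  DecidableEquality A →
  (code : ∀ w → P w → Fin N) →
  (∀ w w' (q : P w) (q' : P w') → code w q ≡ code w' q' → w ≡ w') →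
  (f : ℕ → A) → (∀ i → i < N → P (f i)) →
  (∀ i j → i < N → j < N → f i ≡ f j → i ≡ j) →
  ∀ w → P w → Σ ℕ (λ i → i < N × f i ≡ w)
injective-segment-exhausts {N = N} _≟A_ code code-inj f f-P f-inj w w-P
  with any? (λ i → f (toℕ i) ≟A w)
... | yes (i , fi≡w) = toℕ i , toℕ<n i , fi≡w
... | no w-missing = ⊥-elim (no-collision (pigeonhole (n<1+n N) codes))
  where
  codes : Fin (suc N) → Fin N
  codes i with toℕ i <? N
  ... | yes i<N = code (f (toℕ i)) (f-P (toℕ i) i<N)
  ... | no  _   = code w w-P

  no-collision : ∃₂ (λ i j → i Fin.< j × codes i ≡ codes j) → ⊥
  no-collision (i , j , i<j , eq) with toℕ i <? N | toℕ j <? N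
  ... | yes i<N | yes j<N = <⇒≢ i<j (f-inj _ _ i<N j<N (code-inj _ _ _ _ eq))
  ... | yes i<N | no  _   = w-missing (fromℕ< i<N , fi≡w)
    where
    fi≡w : f (toℕ (fromℕ< i<N)) ≡ w
    fi≡w = subst (λ t → f t ≡ w) (sym (toℕ-fromℕ< i<N)) (code-inj _ _ _ _ eq)
  ... | no  i≮N | _       = i≮N (<-≤-trans i<j (s≤s⁻¹ (toℕ<n j)))

segment-contains : ∀ m k (x : ℕ → Vec ℕ (suc m)) → IsDeBruijnSegment m k x →
  (w : Vec ℕ (suc m)) → All (_< k) w → Σ ℕ (λ i → i < k ^ suc m × x i ≡ w)
segment-contains m k x (bounded , distinct , _) =
  injective-segment-exhausts (≡-dec _≟_) encode encode-injective x bounded distinct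

letters-≤-maxLetter : ∀ {n} (y : Vec ℕ n) τ → maxLetter y ≤ τ → All (_< suc τ) y
letters-≤-maxLetter []      τ _ = []
letters-≤-maxLetter (b ∷ y) τ le =
  s≤s (≤-trans (m≤m⊔n b (maxLetter y)) le)
  ∷ letters-≤-maxLetter y τ (≤-trans (m≤n⊔m b (maxLetter y)) le)

All-∷ʳ : ∀ {P : ℕ → Set} {n} (y : Vec ℕ n) τ → All P y → P τ → All P (y ∷ʳ τ)
All-∷ʳ []      τ []       pτ = pτ ∷ []
All-∷ʳ (b ∷ y) τ (pb ∷ py) pτ = pb ∷ All-∷ʳ y τ py pτ

All-∷ʳ-last : ∀ {P : ℕ → Set} {n} (y : Vec ℕ n) τ → All P (y ∷ʳ τ) → P τ
All-∷ʳ-last []      τ (pτ ∷ _) = pτ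
All-∷ʳ-last (b ∷ y) τ (_ ∷ ps) = All-∷ʳ-last y τ ps

index-below : ∀ m k (x : ℕ → Vec ℕ (suc m)) → IsOnionDeBruijn m x → 1 ≤ k →
  (w : Vec ℕ (suc m)) → All (_< k) w → ∀ i → x i ≡ w → i < k ^ suc m
index-below m k x ((_ , unique , _) , onion) 1≤k w w-in-[k]ⁿ i xi≡w
  with segment-contains m k x (onion k 1≤k) w w-in-[k]ⁿ
... | a , a<kⁿ , xa≡w = subst (_< k ^ suc m) (sym (unique i a (trans xi≡w (sym xa≡w)))) a<kⁿ

index-not-below : ∀ m k (x : ℕ → Vec ℕ (suc m)) → IsOnionDeBruijn m x → 1 ≤ k →
  (y : Vec ℕ m) (τ : ℕ) → k ≤ τ → ∀ j → x j ≡ y ∷ʳ τ → k ^ suc m ≤ j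
index-not-below m k x (_ , onion) 1≤k y τ k≤τ j xj≡yτ with j <? k ^ suc m
... | no  j≮kⁿ = ≮⇒≥ j≮kⁿ
... | yes j<kⁿ = ⊥-elim (<⇒≱ τ<k k≤τ)
  where
  τ<k : τ < k
  τ<k = All-∷ʳ-last y τ (subst (All (_< k)) xj≡yτ (proj₁ (onion k 1≤k) j j<kⁿ))

mainTheorem2 : (m : ℕ) (x : ℕ → Vec ℕ (suc m)) → IsOnionDeBruijn m x →
    (y : Vec ℕ m) (τ τ' : ℕ) → maxLetter y ≤ τ → τ < τ' →
    (i j : ℕ) → x i ≡ y ∷ʳ τ → x j ≡ y ∷ʳ τ' → i < j
mainTheorem2 m x onion y τ τ' μ≤τ τ<τ' i j xi≡yτ xj≡yτ' =
  <-≤-trans (index-below m (suc τ) x onion (s≤s z≤n) (y ∷ʳ τ) yτ-in-[k]ⁿ i xi≡yτ)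
            (index-not-below m (suc τ) x onion (s≤s z≤n) y τ' τ<τ' j xj≡yτ')
  where
  yτ-in-[k]ⁿ : All (_< suc τ) (y ∷ʳ τ)
  yτ-in-[k]ⁿ = All-∷ʳ y τ (letters-≤-maxLetter y τ μ≤τ) ≤-refl
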